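{- Let $\mathcal{C}$ be a pure $2$-dimensional $1$-decomposable simplicial complex. Suppose $e$ is an edge (between two vertices of $\mathcal{C}$) that is not in the graph $\mathrm{skel}(\mathcal{C})$ but such that $\mathrm{skel}(\mathcal{C})+e$ contains a $3$-clique using $e$. Then there exists a $3$-element set $H$ such that $\mathcal{C}+H$ is $1$-decomposable and $\mathrm{skel}(\mathcal{C}+H)=\mathrm{skel}(\mathcal{C})+e$.
   Context: $\mathcal{C}+H$ denotes the complex generated by the facets of $\mathcal{C}$ together with $H$. For a nonempty face $F$: $\mathrm{lk}_F\mathcal{C}=\{G\in\mathcal{C}: G\cap F=\emptyset, G\cup F\in\mathcal{C}\}$, $\mathrm{del}_F\mathcal{C}=\{G\in\mathcal{C}: F\not\subseteq G\}$. A pure $d$-dimensional complex is $k$-decomposable if it is a simplex (one facet), or it has a face $F$ with $\dim F=|F|-1\le k$ such that $\mathrm{del}_F\mathcal{C}$ and $\mathrm{lk}_F\mathcal{C}$ are $k$-decomposable and $\mathrm{del}_F\mathcal{C}$ is pure of dimension $d$. $\mathrm{skel}(\mathcal{C})$ is the graph on the vertices of $\mathcal{C}$ whose edges are the $2$-element faces of $\mathcal{C}$. -}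

module Defs where

open import Level using (0ℓ; suc)
open import Data.Nat using (ℕ; _≤_; _∸_)
open import Data.Fin using (Fin)
open import Data.Fin.Subset using (Subset; ⁅_⁆; _∪_; _∩_; _⊆_; ∣_∣; ⊥; Nonempty)
open import Data.Product using (Σ; ∃; _×_)
open import Data.Sum using (_⊎_)
open import Relation.Binary.PropositionalEquality using (_≡_; _≢_)
open import Relation.Nullary using (¬_)

-- A (finite) simplicial complex on the vertex set Fin n is given by the
-- predicate "G is a face"; faces are subsets of Fin n.
Complex : ℕ → Set₁
Complex n = Subset n → Set

module _ {n : ℕ} where

  IsComplex : Complex n → Set
  IsComplex C = ∀ F G → C F → G ⊆ F → C G

  -- pure with facets of cardinality s (i.e. pure of dimension s - 1)
  PureSize : ℕ → Complex n → Set
  PureSize s C = (∀ G → C G → ∣ G ∣ ≤ s)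
               × (∀ G → C G → Σ (Subset n) λ F → C F × G ⊆ F × ∣ F ∣ ≡ s)

  IsSimplex : Complex n → Set
  IsSimplex C = Σ (Subset n) λ S → ∀ G → (C G → G ⊆ S) × (G ⊆ S → C G)

  lk : Subset n → Complex n → Complex n
  lk F C G = (G ∩ F ≡ ⊥) × C (G ∪ F)

  del : Subset n → Complex n → Complex n
  del F C G = C G × ¬ (F ⊆ G)

  _+ₕ_ : Complex n → Subset n → Complex n
  (C +ₕ H) G = C G ⊎ G ⊆ H

  pair : Fin n → Fin n → Subset n
  pair u v = ⁅ u ⁆ ∪ ⁅ v ⁆

  -- k-decomposability of a pure complex whose facets have cardinality s
  -- (dimension d = s - 1).  A face F has dimension ≤ k iff ∣ F ∣ ≤ k + 1.
  data Decomp (k : ℕ) : ℕ → Complex n → Set₁ where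
    simplex : ∀ {s C} → PureSize s C → IsSimplex C → Decomp k s C
    step    : ∀ {s C} (F : Subset n) → PureSize s C →
              C F → Nonempty F → ∣ F ∣ ≤ Data.Nat.suc k →
              PureSize s (del F C) →
              Decomp k s (del F C) →
              Decomp k (s ∸ ∣ F ∣) (lk F C) →
              Decomp k s C

  Vertex : Complex n → Fin n → Set
  Vertex C v = C ⁅ v ⁆

{-# OPTIONS --safe #-}
module Submission where

open import Defs
open import Data.Nat using (ℕ)
open import Data.Fin using (Fin)
open import Data.Fin.Subset using (Subset; ∣_∣)
open import Data.Product using (Σ; _×_)
open import Function.Bundles using (_⇔_)
open import Data.Sum using (_⊎_)
open import Relation.Binary.PropositionalEquality using (_≡_; _≢_)
open import Relation.Nullary using (¬_)

open import Data.Nat using (suc; _+_; _∸_; _≤_)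
open import Data.Nat.Properties using (≤-trans; ≤-reflexive; +-suc; m+n∸m≡n; <⇒≱; n<1+n)
open import Data.Fin using (zero)
open import Data.Fin.Subset
  using (_∈_; _∉_; _⊆_; _∪_; _∩_; ⁅_⁆; Nonempty; Empty; inside; outside)
open import Data.Fin.Subset.Properties
open import Data.Vec using (_∷_; [])
open import Data.Vec.Base using (here)
open import Data.Product using (_,_; proj₁; map₁)
open import Data.Sum using (inj₁; inj₂; [_,_]′)
open import Data.Empty using (⊥-elim)
open import Function using (id; _∘_)
open import Function.Bundles using (mk⇔)
open import Relation.Binary.PropositionalEquality using (refl; sym; trans; cong; cong₂; subst; subst₂)
open import Relation.Nullary using (yes; no; contradiction)
open import Relation.Unary using (_≐_)
open import Relation.Unary.Properties using (≐-sym)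

-- Put H = {u, v, w} and shed the new edge {u, v} from C + H.  Its deletion is C
-- itself, because every other subset of H lies in one of the edges {u, w},
-- {v, w} of C, and its link is the single vertex w.  Both are 1-decomposable,
-- hence so is C + H; and {u, v} is the only edge of H that C lacks.

private
  variable
    n k s : ℕ
    C D : Complex n
    F G H K S : Subset n
    u v w : Fin n

∈-pairˡ : (u v : Fin n) → u ∈ pair u v
∈-pairˡ u v = x∈p∪q⁺ (inj₁ (x∈⁅x⁆ u))

∈-pairʳ : (u v : Fin n) → v ∈ pair u v
∈-pairʳ u v = x∈p∪q⁺ (inj₂ (x∈⁅x⁆ v))

pair-⊆ : u ∈ S → v ∈ S → pair u v ⊆ S
pair-⊆ {u = u} {S = S} {v = v} u∈S v∈S x∈uv with x∈p∪q⁻ ⁅ u ⁆ ⁅ v ⁆ x∈uv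
... | inj₁ x∈⁅u⁆ = subst (_∈ S) (sym (x∈⁅y⁆⇒x≡y u x∈⁅u⁆)) u∈S
... | inj₂ x∈⁅v⁆ = subst (_∈ S) (sym (x∈⁅y⁆⇒x≡y v x∈⁅v⁆)) v∈S

pair-comm : (u v : Fin n) → pair u v ≡ pair v u
pair-comm u v = ∪-comm ⁅ u ⁆ ⁅ v ⁆

∉-pair : w ≢ u → w ≢ v → w ∉ pair u v
∉-pair {u = u} {v = v} w≢u w≢v w∈uv with x∈p∪q⁻ ⁅ u ⁆ ⁅ v ⁆ w∈uv
... | inj₁ w∈⁅u⁆ = w≢u (x∈⁅y⁆⇒x≡y u w∈⁅u⁆)
... | inj₂ w∈⁅v⁆ = w≢v (x∈⁅y⁆⇒x≡y v w∈⁅v⁆)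

pair⊈⁅x⁆ : u ≢ v → (x : Fin n) → ¬ pair u v ⊆ ⁅ x ⁆
pair⊈⁅x⁆ {u = u} {v = v} u≢v x uv⊆x =
  u≢v (trans (x∈⁅y⁆⇒x≡y x (uv⊆x (∈-pairˡ u v))) (sym (x∈⁅y⁆⇒x≡y x (uv⊆x (∈-pairʳ u v)))))

Empty-∩⁅x⁆ : w ∉ S → Empty (S ∩ ⁅ w ⁆)
Empty-∩⁅x⁆ {w = w} {S = S} w∉S (x , x∈S∩w) with x∈p∩q⁻ S ⁅ w ⁆ x∈S∩w
... | x∈S , x∈⁅w⁆ = w∉S (subst (_∈ S) (x∈⁅y⁆⇒x≡y w x∈⁅w⁆) x∈S)

⊆∪⁅x⁆⇒⊆ : G ⊆ S ∪ ⁅ w ⁆ → w ∉ G → G ⊆ S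
⊆∪⁅x⁆⇒⊆ {S = S} {w = w} G⊆ w∉G {x} x∈G with x∈p∪q⁻ S ⁅ w ⁆ (G⊆ x∈G)
... | inj₁ x∈S   = x∈S
... | inj₂ x∈⁅w⁆ = contradiction (subst (_∈ _) (x∈⁅y⁆⇒x≡y w x∈⁅w⁆) x∈G) w∉G

∣p∪q∣≡∣p∣+∣q∣ : (p q : Subset n) → Empty (p ∩ q) → ∣ p ∪ q ∣ ≡ ∣ p ∣ + ∣ q ∣
∣p∪q∣≡∣p∣+∣q∣ []            []            _    = refl
∣p∪q∣≡∣p∣+∣q∣ (inside  ∷ p) (inside  ∷ q) disj = contradiction (zero , here) disj
∣p∪q∣≡∣p∣+∣q∣ (inside  ∷ p) (outside ∷ q) disj =
  cong suc (∣p∪q∣≡∣p∣+∣q∣ p q (drop-∷-Empty disj))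
∣p∪q∣≡∣p∣+∣q∣ (outside ∷ p) (inside  ∷ q) disj =
  trans (cong suc (∣p∪q∣≡∣p∣+∣q∣ p q (drop-∷-Empty disj))) (sym (+-suc ∣ p ∣ ∣ q ∣))
∣p∪q∣≡∣p∣+∣q∣ (outside ∷ p) (outside ∷ q) disj = ∣p∪q∣≡∣p∣+∣q∣ p q (drop-∷-Empty disj)

∣pair∣≡2 : u ≢ v → ∣ pair u v ∣ ≡ 2
∣pair∣≡2 {u = u} {v = v} u≢v =
  trans (∣p∪q∣≡∣p∣+∣q∣ ⁅ u ⁆ ⁅ v ⁆ (Empty-∩⁅x⁆ (x≢y⇒x∉⁅y⁆ (u≢v ∘ sym))))
        (cong₂ _+_ (∣⁅x⁆∣≡1 u) (∣⁅x⁆∣≡1 v))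

PureSize-resp-≐ : C ≐ D → PureSize s C → PureSize s D
PureSize-resp-≐ (C⊆D , D⊆C) (bounded , extends) =
  (λ G → bounded G ∘ D⊆C) ,
  (λ G G∈D → let (F , F∈C , G⊆F , ∣F∣≡s) = extends G (D⊆C G∈D) in F , C⊆D F∈C , G⊆F , ∣F∣≡s)

IsSimplex-resp-≐ : C ≐ D → IsSimplex C → IsSimplex D
IsSimplex-resp-≐ (C⊆D , D⊆C) (S , faces) =
  S , λ G → let (C⇒⊆ , ⊆⇒C) = faces G in C⇒⊆ ∘ D⊆C , C⊆D ∘ ⊆⇒C

del-resp-≐ : (F : Subset n) → C ≐ D → del F C ≐ del F D
del-resp-≐ F (C⊆D , D⊆C) = map₁ C⊆D , map₁ D⊆C

lk-resp-≐ : (F : Subset n) → C ≐ D → lk F C ≐ lk F D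
lk-resp-≐ F (C⊆D , D⊆C) = (λ (disj , G∪F∈C) → disj , C⊆D G∪F∈C) ,
                          (λ (disj , G∪F∈D) → disj , D⊆C G∪F∈D)

Decomp-resp-≐ : C ≐ D → Decomp k s C → Decomp k s D
Decomp-resp-≐ C≐D (simplex pure single) =
  simplex (PureSize-resp-≐ C≐D pure) (IsSimplex-resp-≐ C≐D single)
Decomp-resp-≐ C≐D (step F pure F∈C F≢∅ ∣F∣≤ pure-del dec-del dec-lk) =
  step F (PureSize-resp-≐ C≐D pure) (proj₁ C≐D F∈C) F≢∅ ∣F∣≤
       (PureSize-resp-≐ (del-resp-≐ F C≐D) pure-del)
       (Decomp-resp-≐ (del-resp-≐ F C≐D) dec-del)
       (Decomp-resp-≐ (lk-resp-≐ F C≐D) dec-lk)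

simplexOn : Subset n → Complex n
simplexOn S G = G ⊆ S

Decomp-simplexOn : ∣ S ∣ ≡ s → Decomp k s (simplexOn S)
Decomp-simplexOn {S = S} ∣S∣≡s =
  simplex ((λ G G⊆S → ≤-trans (p⊆q⇒∣p∣≤∣q∣ G⊆S) (≤-reflexive ∣S∣≡s)) ,
           (λ G G⊆S → S , id , G⊆S , ∣S∣≡s))
          (S , λ G → id , id)

PureSize-+ₕ : PureSize s C → ∣ H ∣ ≡ s → PureSize s (C +ₕ H)
PureSize-+ₕ {s = s} {C = C} {H = H} (bounded , extends) ∣H∣≡s = bounded′ , extends′
  where
  bounded′ : ∀ G → (C +ₕ H) G → ∣ G ∣ ≤ s
  bounded′ G (inj₁ G∈C) = bounded G G∈C
  bounded′ G (inj₂ G⊆H) = ≤-trans (p⊆q⇒∣p∣≤∣q∣ G⊆H) (≤-reflexive ∣H∣≡s)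

  extends′ : ∀ G → (C +ₕ H) G → Σ (Subset _) λ F → (C +ₕ H) F × G ⊆ F × ∣ F ∣ ≡ s
  extends′ G (inj₁ G∈C) = let (F , F∈C , G⊆F , ∣F∣≡s) = extends G G∈C in
                          F , inj₁ F∈C , G⊆F , ∣F∣≡s
  extends′ G (inj₂ G⊆H) = H , inj₂ id , G⊆H , ∣H∣≡s

del-+ₕ : IsComplex C → ¬ C F → (∀ G → G ⊆ H → ¬ F ⊆ G → C G) → del F (C +ₕ H) ≐ C
del-+ₕ {C = C} {F = F} {H = H} closed F∉C faces =
  del⊆C , λ {G} G∈C → inj₁ G∈C , F∉C ∘ closed G F G∈C
  where
  del⊆C : ∀ {G} → del F (C +ₕ H) G → C G
  del⊆C     (inj₁ G∈C , _)     = G∈C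
  del⊆C {G} (inj₂ G⊆H , F⊈G) = faces G G⊆H F⊈G

lk-+ₕ : IsComplex C → ¬ C F → Empty (F ∩ K) → lk F (C +ₕ (F ∪ K)) ≐ simplexOn K
lk-+ₕ {C = C} {F = F} {K = K} closed F∉C disj = lk⊆K , K⊆lk
  where
  lk⊆K : ∀ {G} → lk F (C +ₕ (F ∪ K)) G → G ⊆ K
  lk⊆K {G} (_ , inj₁ G∪F∈C) = contradiction (closed _ F G∪F∈C (q⊆p∪q G F)) F∉C
  lk⊆K {G} (G∩F≡∅ , inj₂ G∪F⊆F∪K) {x} x∈G with x∈p∪q⁻ F K (G∪F⊆F∪K (p⊆p∪q F x∈G))
  ... | inj₁ x∈F = contradiction (subst (x ∈_) G∩F≡∅ (x∈p∩q⁺ (x∈G , x∈F))) ∉⊥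
  ... | inj₂ x∈K = x∈K

  K⊆lk : ∀ {G} → G ⊆ K → lk F (C +ₕ (F ∪ K)) G
  K⊆lk {G} G⊆K = Empty-unique G∩F-empty , inj₂ G∪F⊆F∪K
    where
    G∩F-empty : Empty (G ∩ F)
    G∩F-empty (x , x∈G∩F) with x∈p∩q⁻ G F x∈G∩F
    ... | x∈G , x∈F = disj (x , x∈p∩q⁺ (x∈F , G⊆K x∈G))

    G∪F⊆F∪K : G ∪ F ⊆ F ∪ K
    G∪F⊆F∪K x∈G∪F = [ q⊆p∪q F K ∘ G⊆K , p⊆p∪q K ]′ (x∈p∪q⁻ G F x∈G∪F)

Decomp-+ₕ : IsComplex C → PureSize s C → Decomp k s C →
            Nonempty F → ∣ F ∣ ≤ suc k → ¬ C F →
            Empty (F ∩ K) → ∣ F ∣ + ∣ K ∣ ≡ s →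
            (∀ G → G ⊆ F ∪ K → ¬ F ⊆ G → C G) →
            Decomp k s (C +ₕ (F ∪ K))
Decomp-+ₕ {C = C} {s = s} {F = F} {K = K} closed pure dec F≢∅ ∣F∣≤ F∉C disj ∣F∣+∣K∣≡s faces =
  step F (PureSize-+ₕ pure ∣F∪K∣≡s) (inj₂ (p⊆p∪q K)) F≢∅ ∣F∣≤
       (PureSize-resp-≐ (≐-sym del≐C) pure)
       (Decomp-resp-≐ (≐-sym del≐C) dec)
       (Decomp-resp-≐ (≐-sym (lk-+ₕ closed F∉C disj)) (Decomp-simplexOn ∣K∣≡s∸∣F∣))
  where
  del≐C : del F (C +ₕ (F ∪ K)) ≐ C
  del≐C = del-+ₕ closed F∉C faces

  ∣F∪K∣≡s : ∣ F ∪ K ∣ ≡ s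
  ∣F∪K∣≡s = trans (∣p∪q∣≡∣p∣+∣q∣ F K disj) ∣F∣+∣K∣≡s

  ∣K∣≡s∸∣F∣ : ∣ K ∣ ≡ s ∸ ∣ F ∣
  ∣K∣≡s∸∣F∣ = trans (sym (m+n∸m≡n ∣ F ∣ ∣ K ∣)) (cong (_∸ ∣ F ∣) ∣F∣+∣K∣≡s)

triangle : Fin n → Fin n → Fin n → Subset n
triangle u v w = pair u v ∪ ⁅ w ⁆

triangle-rotate : (u v w : Fin n) → triangle u v w ≡ triangle v w u
triangle-rotate u v w = trans (∪-assoc ⁅ u ⁆ ⁅ v ⁆ ⁅ w ⁆) (∪-comm ⁅ u ⁆ (pair v w))

module Triangle {C : Complex n} (closed : IsComplex C) {u v w : Fin n}
                (u≢v : u ≢ v) (w≢u : w ≢ u) (w≢v : w ≢ v)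
                (uw∈C : C (pair u w)) (vw∈C : C (pair v w)) where

  ∣pair∣+∣⁅w⁆∣≡3 : ∣ pair u v ∣ + ∣ ⁅ w ⁆ ∣ ≡ 3
  ∣pair∣+∣⁅w⁆∣≡3 = cong₂ _+_ (∣pair∣≡2 u≢v) (∣⁅x⁆∣≡1 w)

  uv∩w-empty : Empty (pair u v ∩ ⁅ w ⁆)
  uv∩w-empty = Empty-∩⁅x⁆ (∉-pair w≢u w≢v)

  ∣triangle∣≡3 : ∣ triangle u v w ∣ ≡ 3
  ∣triangle∣≡3 = trans (∣p∪q∣≡∣p∣+∣q∣ (pair u v) ⁅ w ⁆ uv∩w-empty) ∣pair∣+∣⁅w⁆∣≡3

  ⊆triangle⇒face : ∀ G → G ⊆ triangle u v w → ¬ pair u v ⊆ G → C G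
  ⊆triangle⇒face G G⊆uvw uv⊈G with u ∈? G | v ∈? G
  ... | yes u∈G | yes v∈G = ⊥-elim (uv⊈G (pair-⊆ u∈G v∈G))
  ... | no  u∉G | _       =
    closed _ G vw∈C (⊆∪⁅x⁆⇒⊆ (subst (G ⊆_) (triangle-rotate u v w) G⊆uvw) u∉G)
  ... | yes _   | no  v∉G =
    closed _ G (subst C (pair-comm u w) uw∈C)
      (⊆∪⁅x⁆⇒⊆ (subst (G ⊆_) (trans (triangle-rotate u v w) (triangle-rotate v w u)) G⊆uvw) v∉G)

  vertex-+ₕ : ∀ x → Vertex (C +ₕ triangle u v w) x ⇔ Vertex C x
  vertex-+ₕ x = mk⇔ to inj₁
    where
    to : Vertex (C +ₕ triangle u v w) x → Vertex C x
    to (inj₁ x∈C)   = x∈C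
    to (inj₂ x⊆uvw) = ⊆triangle⇒face ⁅ x ⁆ x⊆uvw (pair⊈⁅x⁆ u≢v x)

  edge-+ₕ : ∀ a b → a ≢ b →
            (C +ₕ triangle u v w) (pair a b) ⇔ (C (pair a b) ⊎ pair a b ≡ pair u v)
  edge-+ₕ a b a≢b = mk⇔ to from
    where
    to : (C +ₕ triangle u v w) (pair a b) → C (pair a b) ⊎ pair a b ≡ pair u v
    to (inj₁ ab∈C) = inj₁ ab∈C
    to (inj₂ ab⊆uvw) with pair u v ⊆? pair a b
    ... | no  uv⊈ab = inj₁ (⊆triangle⇒face _ ab⊆uvw uv⊈ab)
    ... | yes uv⊆ab = inj₂ (⊆-antisym (⊆∪⁅x⁆⇒⊆ ab⊆uvw w∉ab) uv⊆ab)
      where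
      uvw⊆ab : w ∈ pair a b → triangle u v w ⊆ pair a b
      uvw⊆ab w∈ab x∈uvw with x∈p∪q⁻ (pair u v) ⁅ w ⁆ x∈uvw
      ... | inj₁ x∈uv  = uv⊆ab x∈uv
      ... | inj₂ x∈⁅w⁆ = subst (_∈ pair a b) (sym (x∈⁅y⁆⇒x≡y w x∈⁅w⁆)) w∈ab

      w∉ab : w ∉ pair a b
      w∉ab w∈ab = <⇒≱ (n<1+n 2)
        (subst₂ _≤_ ∣triangle∣≡3 (∣pair∣≡2 a≢b) (p⊆q⇒∣p∣≤∣q∣ (uvw⊆ab w∈ab)))

    from : C (pair a b) ⊎ pair a b ≡ pair u v → (C +ₕ triangle u v w) (pair a b)
    from (inj₁ ab∈C)  = inj₁ ab∈C
    from (inj₂ ab≡uv) = inj₂ (subst (_⊆ triangle u v w) (sym ab≡uv) (p⊆p∪q ⁅ w ⁆))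

lemma3p7 : {n : ℕ} (C : Complex n) → IsComplex C →
    PureSize 3 C → Decomp 1 3 C →
    (u v : Fin n) → u ≢ v → Vertex C u → Vertex C v → ¬ C (pair u v) →
    (Σ (Fin n) λ w → w ≢ u × w ≢ v × C (pair u w) × C (pair v w)) →
    Σ (Subset n) λ H → ∣ H ∣ ≡ 3 × Decomp 1 3 (C +ₕ H)
      × (∀ x → Vertex (C +ₕ H) x ⇔ Vertex C x)
      × (∀ a b → a ≢ b →
          (C +ₕ H) (pair a b) ⇔ (C (pair a b) ⊎ pair a b ≡ pair u v))
lemma3p7 C closed pure dec u v u≢v _ _ uv∉C (w , w≢u , w≢v , uw∈C , vw∈C) =
  triangle u v w , ∣triangle∣≡3 ,
  Decomp-+ₕ closed pure dec (u , ∈-pairˡ u v) (≤-reflexive (∣pair∣≡2 u≢v)) uv∉C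
            uv∩w-empty ∣pair∣+∣⁅w⁆∣≡3 ⊆triangle⇒face ,
  vertex-+ₕ , edge-+ₕ
  where open Triangle closed u≢v w≢u w≢v uw∈C vw∈C
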